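{- Let $M,N$ be sharp, integral monoids, let $\Gamma$ be an $M$-metrised graph, let $f:M\to N$ be a homomorphism, let $\Gamma'$ be the edge contraction of $\Gamma$ along $f$, and let $D\in\operatorname{Div}(\Gamma)$. Then $r(f_*(D))\ge r(D)$.
   Context: Monoids: commutative, sharp, integral; $(\cdot)^{gp}$ groupification. A graph is $(X,r,i)$: $X$ finite, $r$ idempotent, $i$ involution, $i(x)=x\iff r(x)=x$; vertices $V$ = fixed points, half-edges $H=X\setminus V$, $H_v=\{e:r(e)=v\}$; connected. $M$-metrised: $l:X\to M$, $l\circ i=l$, $l(x)=0\iff x\in V$. $\operatorname{PL}(\Gamma)=\{g:V\to M^{gp}: g(r(e))-g(r(i(e)))\in\langle l(e)\rangle\}$; $\Delta(g)=\sum_v\sum_{e\in H_v}\frac{g(v)-g(r(i(e)))}{l(e)}[v]$; $D\sim D'$ iff $D-D'\in\Delta(\operatorname{PL}(\Gamma))$; $|D|=\{E\ge0:E\sim D\}$; $r(D)=\max\{k\in\mathbb Z:|D-F|\ne\emptyset$ for all effective $F$ of degree $k\}$. The edge contraction $\Gamma'$ along $f$ is the quotient identifying $e\sim r(e)\sim i(e)\sim r(i(e))$ whenever $f(l(e))=0$, with lengths $f\circ l$; $\varphi:\Gamma\to\Gamma'$ the quotient map, and $f_*(D)=\sum_vD(v)[\varphi(v)]$. -}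

module Defs where

open import Level using (Level; _⊔_)
open import Data.Nat using (ℕ; zero; suc)
open import Data.Integer using (ℤ; +_; -[1+_]; _≤_; _-_; _+_; 0ℤ)
open import Data.Fin using (Fin; zero; suc)
open import Data.Fin.Properties using (_≟_)
open import Data.Sum using (_⊎_)
open import Data.Product using (Σ; Σ-syntax; ∃; _×_; _,_; proj₁; proj₂)
open import Relation.Nullary using (¬_; yes; no)
open import Relation.Binary.PropositionalEquality using (_≡_)
open import Relation.Binary.Construct.Closure.ReflexiveTransitive using (Star)
open import Relation.Binary.Construct.Closure.Equivalence using (EqClosure)
open import Algebra.Bundles using (CommutativeMonoid)
open import Algebra.Morphism.Structures using (module MonoidMorphisms)

sumFin : ∀ {n} → (Fin n → ℤ) → ℤ
sumFin {zero}  f = 0ℤ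
sumFin {suc n} f = f zero + sumFin (λ x → f (suc x))

VertexOf : ∀ {n} → (Fin n → Fin n) → Set
VertexOf {n} r = Σ (Fin n) (λ x → r x ≡ x)

AdjOf : ∀ {n} → (Fin n → Fin n) → (Fin n → Fin n) → Fin n → Fin n → Set
AdjOf {n} r i x y = Σ[ e ∈ Fin n ] (¬ (r e ≡ e) × r e ≡ x × r (i e) ≡ y)

record Graph (n : ℕ) : Set where
  field
    r i     : Fin n → Fin n
    r-idem  : ∀ x → r (r x) ≡ r x
    i-invol : ∀ x → i (i x) ≡ x
    fix→    : ∀ x → i x ≡ x → r x ≡ x
    fix←    : ∀ x → r x ≡ x → i x ≡ x
    connected : (v w : VertexOf r) → Star (AdjOf r i) (proj₁ v) (proj₁ w)

module Theory {c ℓ} (M : CommutativeMonoid c ℓ) where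
  open CommutativeMonoid M

  IsSharp : Set (c ⊔ ℓ)
  IsSharp = ∀ x y → (x ∙ y) ≈ ε → x ≈ ε

  IsIntegral : Set (c ⊔ ℓ)
  IsIntegral = ∀ x y z → (x ∙ y) ≈ (x ∙ z) → y ≈ z

  nmul : ℕ → Carrier → Carrier
  nmul zero    x = ε
  nmul (suc k) x = x ∙ nmul k x

  -- Groupification M^gp of an integral monoid: pairs (a , b) standing for a - b
  Gp : Set c
  Gp = Carrier × Carrier

  _≈ᵍ_ : Gp → Gp → Set ℓ
  (a , b) ≈ᵍ (c' , d) = (a ∙ d) ≈ (c' ∙ b)

  _-ᵍ_ : Gp → Gp → Gp
  (a , b) -ᵍ (c' , d) = (a ∙ d , b ∙ c')

  zmul : ℤ → Carrier → Gp
  zmul (+ k)     x = (nmul k x , ε)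
  zmul -[1+ k ]  x = (ε , nmul (suc k) x)

  record MGraph : Set (c ⊔ ℓ) where
    field
      size  : ℕ
      graph : Graph size
    open Graph graph
    field
      len      : Fin size → Carrier
      len-i    : ∀ x → len (i x) ≈ len x
      len-zero→ : ∀ x → len x ≈ ε → r x ≡ x
      len-zero← : ∀ x → r x ≡ x → len x ≈ ε

  module _ (Γ : MGraph) where
    open MGraph Γ
    open Graph graph

    Vertex : Set
    Vertex = VertexOf r

    Div : Set
    Div = Vertex → ℤ

    coeff : Div → Fin size → ℤ
    coeff D x with r x ≟ x
    ... | yes p = D (x , p)
    ... | no  _ = 0ℤ

    deg : Div → ℤ
    deg D = sumFin (coeff D)

    Effective : Div → Set
    Effective D = ∀ v → 0ℤ ≤ D v

    -- contribution of e to the sum over H_v (e ∈ H_v iff e ≠ v and r e = v)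
    halfAt : Vertex → Fin size → ℤ → ℤ
    halfAt v e z with e ≟ proj₁ v
    ... | yes _ = 0ℤ
    ... | no  _ with r e ≟ proj₁ v
    ...   | yes _ = z
    ...   | no  _ = 0ℤ

    vtx : Fin size → Vertex
    vtx e = (r e , r-idem e)

    -- D ∼ D' iff D - D' = Δ(g) for some g ∈ PL(Γ).  The integers s e are the
    -- slopes (g(r e) - g(r (i e))) / l(e) witnessing g ∈ PL(Γ).
    _∼_ : Div → Div → Set (c ⊔ ℓ)
    D ∼ D' = Σ[ g ∈ (Vertex → Gp) ] Σ[ s ∈ (Fin size → ℤ) ]
      ( ((e : Fin size) → ¬ (r e ≡ e) →
            (g (vtx e) -ᵍ g (vtx (i e))) ≈ᵍ zmul (s e) (len e))
      × ((v : Vertex) → D v - D' v ≡ sumFin (λ e → halfAt v e (s e))) )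

    LinSysNonempty : Div → Set (c ⊔ ℓ)
    LinSysNonempty D = Σ[ E ∈ Div ] (Effective E × (E ∼ D))

    -- k belongs to the set whose maximum is r(D)
    RankCond : Div → ℤ → Set (c ⊔ ℓ)
    RankCond D k = (F : Div) → Effective F → deg F ≡ k →
                   LinSysNonempty (λ v → D v - F v)

    IsRank : Div → ℤ → Set (c ⊔ ℓ)
    IsRank D ρ = RankCond D ρ × (∀ k → RankCond D k → k ≤ ρ)

module Contraction {c₁ ℓ₁ c₂ ℓ₂}
  (M : CommutativeMonoid c₁ ℓ₁) (N : CommutativeMonoid c₂ ℓ₂)
  (f : CommutativeMonoid.Carrier M → CommutativeMonoid.Carrier N)
  (Γ : Theory.MGraph M) (Γ' : Theory.MGraph N) where

  private
    module MM = CommutativeMonoid M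
    module NN = CommutativeMonoid N
    module G  = Theory.MGraph {M = M} Γ
    module G' = Theory.MGraph {M = N} Γ'
    module GG  = Graph G.graph
    module GG' = Graph G'.graph

  X  = Fin G.size
  X' = Fin G'.size

  Near : X → X → Set
  Near x e = x ≡ e ⊎ x ≡ GG.r e ⊎ x ≡ GG.i e ⊎ x ≡ GG.r (GG.i e)

  Step : X → X → Set ℓ₂
  Step x y = Σ[ e ∈ X ] (f (G.len e) NN.≈ NN.ε × Near x e × Near y e)

  record IsContraction (φ : X → X') : Set (c₂ ⊔ ℓ₂) where
    field
      surj     : ∀ y → Σ[ x ∈ X ] φ x ≡ y
      fibre→   : ∀ x y → φ x ≡ φ y → EqClosure Step x y
      fibre←   : ∀ x y → EqClosure Step x y → φ x ≡ φ y
      r-compat : ∀ x → GG'.r (φ x) ≡ φ (GG.r x)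
      i-compat : ∀ x → GG'.i (φ x) ≡ φ (GG.i x)
      l-compat : ∀ x → G'.len (φ x) NN.≈ f (G.len x)

  pushCoeff : (φ : X → X') → Theory.Div M Γ → X' → X → ℤ
  pushCoeff φ D w x with GG.r x ≟ x
  ... | no _ = 0ℤ
  ... | yes p with φ x ≟ w
  ...   | yes _ = D (x , p)
  ...   | no  _ = 0ℤ

  push : (φ : X → X') → Theory.Div M Γ → Theory.Div N Γ'
  push φ D w = sumFin (pushCoeff φ D (proj₁ w))

open MonoidMorphisms public using (IsMonoidHomomorphism)

-- Lift an effective divisor F′ of degree k on Γ′ to an effective divisor F of the same degree on Γ
-- by placing each coefficient at a vertex of Γ over the corresponding vertex of Γ′. As r(D) ≥ k,
-- D − F ∼ E with E effective, and pushing forward gives f_* D − F′ ∼ f_* E with f_* E effective,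
-- because f_* preserves linear equivalence: if D₁ − D₂ = Δ(g) with slopes s, then f ∘ g is constant
-- along contracted edges (there the slope is multiplied by f(l) = 0) and so descends to Γ′; a surviving
-- half-edge has a unique preimage and keeps its slope, while the contracted half-edges over a vertex
-- of Γ′ come in pairs e, i(e) whose slopes cancel, since in a sharp integral monoid slopes are unique
-- and hence s(i e) = −s(e).

module Submission where

open import Defs
open import Level using (Level)
open import Data.Nat using (ℕ; zero; suc) renaming (_+_ to _+ℕ_)
import Data.Nat.Properties as ℕ
open import Data.Integer using (ℤ; +_; -[1+_]; 0ℤ; _+_; _-_; -_; _≤_)
import Data.Integer.Properties as ℤ
open import Data.Integer.Tactic.RingSolver using (solve-∀)
open import Data.Fin using (Fin; zero; suc)
open import Data.Fin.Properties using (_≟_; suc-injective)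
open import Data.Fin.Permutation using (permutation)
open import Data.Product using (_,_; proj₁; proj₂)
open import Data.Sum using (_⊎_; inj₁; inj₂)
open import Function using (_∘_; id)
open import Relation.Nullary using (¬_; Dec; yes; no; ¬?; contradiction)
open import Relation.Binary.PropositionalEquality
  using (_≡_; _≢_; refl; sym; trans; cong; cong₂; subst; module ≡-Reasoning)
open import Axiom.UniquenessOfIdentityProofs using (module Decidable⇒UIP)
open import Algebra.Bundles using (CommutativeMonoid)
open import Relation.Binary.Bundles using (Setoid)
import Relation.Binary.Reasoning.Setoid as SetoidReasoning
open import Algebra.Properties.CommutativeMonoid.Sum ℤ.+-0-commutativeMonoid
  using (sum; sum-cong-≗; ∑-comm; sum-permute)

private
  variable
    p : Level
    P Q : Set p
    n m k : ℕ

when : Dec P → ℤ → ℤ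
when (yes _) z = z
when (no _)  _ = 0ℤ

when-true : (d : Dec P) → P → ∀ z → when d z ≡ z
when-true (yes _) _  _ = refl
when-true (no ¬p) p′ _ = contradiction p′ ¬p

when-false : (d : Dec P) → ¬ P → ∀ z → when d z ≡ 0ℤ
when-false (yes p′) ¬p _ = contradiction p′ ¬p
when-false (no _)   _  _ = refl

when-0 : (d : Dec P) → when d 0ℤ ≡ 0ℤ
when-0 (yes _) = refl
when-0 (no _)  = refl

when-equiv : (P → Q) → (Q → P) → (d : Dec P) (d′ : Dec Q) → ∀ z → when d z ≡ when d′ z
when-equiv to from (yes p′) d′ z = sym (when-true d′ (to p′) z)
when-equiv to from (no ¬p)  d′ z = sym (when-false d′ (¬p ∘ from) z)

when-neg : (d : Dec P) → ∀ z → when d (- z) ≡ - when d z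
when-neg (yes _) _ = refl
when-neg (no _)  _ = refl

when-- : (d : Dec P) → ∀ a b → when d (a - b) ≡ when d a - when d b
when-- (yes _) _ _ = refl
when-- (no _)  _ _ = refl

when-nonneg : (d : Dec P) → ∀ {z} → 0ℤ ≤ z → 0ℤ ≤ when d z
when-nonneg (yes _) z≥0 = z≥0
when-nonneg (no _)  _   = ℤ.≤-refl

when-sum : (d : Dec P) (h : Fin n → ℤ) → when d (sumFin h) ≡ sumFin (λ x → when d (h x))

sum-cong : {h k : Fin n → ℤ} → (∀ x → h x ≡ k x) → sumFin h ≡ sumFin k
sum-cong {zero}  _   = refl
sum-cong {suc n} h≗k = cong₂ _+_ (h≗k zero) (sum-cong (h≗k ∘ suc))

sum-zero : {h : Fin n → ℤ} → (∀ x → h x ≡ 0ℤ) → sumFin h ≡ 0ℤ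
sum-zero {zero}  _    = refl
sum-zero {suc n} h≗0 = cong₂ _+_ (h≗0 zero) (sum-zero (h≗0 ∘ suc))

when-sum (yes _) h = refl
when-sum {n = n} (no _) h = sym (sum-zero {n} (λ _ → refl))

sum-nonneg : (h : Fin n → ℤ) → (∀ x → 0ℤ ≤ h x) → 0ℤ ≤ sumFin h
sum-nonneg {zero}  h h≥0 = ℤ.≤-refl
sum-nonneg {suc n} h h≥0 = ℤ.+-mono-≤ (h≥0 zero) (sum-nonneg (h ∘ suc) (h≥0 ∘ suc))

sum-at : (h : Fin n → ℤ) (a : Fin n) → (∀ x → x ≢ a → h x ≡ 0ℤ) → sumFin h ≡ h a
sum-at h zero    h≗0 = trans (cong (_+_ (h zero)) (sum-zero (λ x → h≗0 (suc x) λ ()))) (ℤ.+-identityʳ _)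
sum-at h (suc a) h≗0 = trans (cong₂ _+_ (h≗0 zero λ ())
                               (sum-at (h ∘ suc) a (λ x x≢a → h≗0 (suc x) (x≢a ∘ suc-injective))))
                             (ℤ.+-identityˡ _)

sum-neg : (h : Fin n → ℤ) → sumFin (λ x → - h x) ≡ - sumFin h
sum-neg {zero}  h = refl
sum-neg {suc n} h = trans (cong (_+_ (- h zero)) (sum-neg (h ∘ suc))) (sym (ℤ.neg-distrib-+ (h zero) _))

sumFin≡sum : (h : Fin n → ℤ) → sumFin h ≡ sum h
sumFin≡sum {zero}  h = refl
sumFin≡sum {suc n} h = cong (_+_ (h zero)) (sumFin≡sum (h ∘ suc))

sum-+ : (h k : Fin n → ℤ) → sumFin (λ x → h x + k x) ≡ sumFin h + sumFin k
sum-+ {zero}  h k = refl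
sum-+ {suc n} h k = trans (cong (_+_ (h zero + k zero)) (sum-+ (h ∘ suc) (k ∘ suc)))
                          (interchange (h zero) (k zero) _ _)
  where
  interchange : ∀ a b c d → a + b + (c + d) ≡ a + c + (b + d)
  interchange = solve-∀

sum-- : (h k : Fin n → ℤ) → sumFin (λ x → h x - k x) ≡ sumFin h - sumFin k
sum-- h k = trans (sum-+ h (λ x → - k x)) (cong (_+_ (sumFin h)) (sum-neg k))

sum-comm : (h : Fin n → Fin m → ℤ) →
           sumFin (λ x → sumFin (h x)) ≡ sumFin (λ y → sumFin (λ x → h x y))
sum-comm h = begin
  sumFin (λ x → sumFin (h x))         ≡⟨ sumFin≡sum (λ x → sumFin (h x)) ⟩
  sum (λ x → sumFin (h x))            ≡⟨ sum-cong-≗ (sumFin≡sum ∘ h) ⟩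
  sum (λ x → sum (h x))               ≡⟨ ∑-comm h ⟩
  sum (λ y → sum (λ x → h x y))       ≡⟨ sum-cong-≗ (λ y → sumFin≡sum (λ x → h x y)) ⟨
  sum (λ y → sumFin (λ x → h x y))    ≡⟨ sumFin≡sum (λ y → sumFin (λ x → h x y)) ⟨
  sumFin (λ y → sumFin (λ x → h x y)) ∎
  where open ≡-Reasoning

sum-involution : (h : Fin n → ℤ) (ι : Fin n → Fin n) → (∀ x → ι (ι x) ≡ x) →
                 sumFin (h ∘ ι) ≡ sumFin h
sum-involution h ι ι∘ι = begin
  sumFin (h ∘ ι) ≡⟨ sumFin≡sum (h ∘ ι) ⟩
  sum (h ∘ ι)    ≡⟨ sum-permute h (permutation ι ι ι∘ι ι∘ι) ⟨
  sum h          ≡⟨ sumFin≡sum h ⟨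
  sumFin h       ∎
  where open ≡-Reasoning

sum-antisymmetric : (h : Fin n → ℤ) (ι : Fin n → Fin n) → (∀ x → ι (ι x) ≡ x) →
                    (∀ x → h (ι x) ≡ - h x) → sumFin h ≡ 0ℤ
sum-antisymmetric h ι ι∘ι h∘ι≡-h = self-negative (begin
  sumFin h               ≡⟨ sum-involution h ι ι∘ι ⟨
  sumFin (h ∘ ι)         ≡⟨ sum-cong h∘ι≡-h ⟩
  sumFin (λ x → - h x)   ≡⟨ sum-neg h ⟩
  - sumFin h             ∎)
  where
  open ≡-Reasoning
  self-negative : ∀ {z} → z ≡ - z → z ≡ 0ℤ
  self-negative {+ zero}   _  = refl
  self-negative {+ suc _}  ()
  self-negative { -[1+ _ ]} ()

infixr 9 _⋆_

_⋆_ : (Fin n → Fin m) → (Fin n → ℤ) → Fin m → ℤ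
(ψ ⋆ h) y = sumFin (λ x → when (ψ x ≟ y) (h x))

sum-⋆ : (ψ : Fin n → Fin m) (h : Fin n → ℤ) → sumFin (ψ ⋆ h) ≡ sumFin h
sum-⋆ ψ h = trans (sum-comm (λ y x → when (ψ x ≟ y) (h x)))
                  (sum-cong λ x → trans (sum-at _ (ψ x) (λ y y≢ψx → when-false (ψ x ≟ y) (y≢ψx ∘ sym) _))
                                        (when-true (ψ x ≟ ψ x) refl _))

⋆-cong : (ψ : Fin n → Fin m) {h k : Fin n → ℤ} → (∀ x → h x ≡ k x) → ∀ y → (ψ ⋆ h) y ≡ (ψ ⋆ k) y
⋆-cong ψ h≗k y = sum-cong λ x → cong (when (ψ x ≟ y)) (h≗k x)

⋆-agree : {ψ χ : Fin n → Fin m} (h : Fin n → ℤ) → (∀ x → ψ x ≡ χ x ⊎ h x ≡ 0ℤ) →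
          ∀ y → (ψ ⋆ h) y ≡ (χ ⋆ h) y
⋆-agree {ψ = ψ} {χ} h agree y = sum-cong term
  where
  term : ∀ x → when (ψ x ≟ y) (h x) ≡ when (χ x ≟ y) (h x)
  term x with agree x
  ... | inj₁ ψx≡χx = cong (λ t → when (t ≟ y) (h x)) ψx≡χx
  ... | inj₂ hx≡0  rewrite hx≡0 = trans (when-0 (ψ x ≟ y)) (sym (when-0 (χ x ≟ y)))

⋆-id : (h : Fin n → ℤ) → ∀ y → (id ⋆ h) y ≡ h y
⋆-id h y = trans (sum-at _ y (λ x x≢y → when-false (x ≟ y) x≢y _)) (when-true (y ≟ y) refl _)

⋆-∘ : (χ : Fin m → Fin k) (ψ : Fin n → Fin m) (h : Fin n → ℤ) →
      ∀ z → (χ ⋆ ψ ⋆ h) z ≡ ((χ ∘ ψ) ⋆ h) z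
⋆-∘ χ ψ h z = begin
  sumFin (λ y → when (χ y ≟ z) (sumFin (λ x → when (ψ x ≟ y) (h x))))
    ≡⟨ sum-cong (λ y → when-sum (χ y ≟ z) (λ x → when (ψ x ≟ y) (h x))) ⟩
  sumFin (λ y → sumFin (λ x → when (χ y ≟ z) (when (ψ x ≟ y) (h x))))
    ≡⟨ sum-comm (λ y x → when (χ y ≟ z) (when (ψ x ≟ y) (h x))) ⟩
  sumFin (λ x → sumFin (λ y → when (χ y ≟ z) (when (ψ x ≟ y) (h x))))
    ≡⟨ sum-cong (λ x → sum-at _ (ψ x) (λ y y≢ψx →
         trans (cong (when (χ y ≟ z)) (when-false (ψ x ≟ y) (y≢ψx ∘ sym) _)) (when-0 (χ y ≟ z)))) ⟩
  sumFin (λ x → when (χ (ψ x) ≟ z) (when (ψ x ≟ ψ x) (h x)))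
    ≡⟨ sum-cong (λ x → cong (when (χ (ψ x) ≟ z)) (when-true (ψ x ≟ ψ x) refl _)) ⟩
  sumFin (λ x → when (χ (ψ x) ≟ z) (h x)) ∎
  where open ≡-Reasoning

⋆-- : (ψ : Fin n → Fin m) (h k : Fin n → ℤ) → ∀ y → (ψ ⋆ (λ x → h x - k x)) y ≡ (ψ ⋆ h) y - (ψ ⋆ k) y
⋆-- ψ h k y = trans (sum-cong λ x → when-- (ψ x ≟ y) (h x) (k x)) (sum-- (λ x → when (ψ x ≟ y) (h x)) (λ x → when (ψ x ≟ y) (k x)))

⋆-nonneg : (ψ : Fin n → Fin m) {h : Fin n → ℤ} → (∀ x → 0ℤ ≤ h x) → ∀ y → 0ℤ ≤ (ψ ⋆ h) y
⋆-nonneg ψ h≥0 y = sum-nonneg _ λ x → when-nonneg (ψ x ≟ y) (h≥0 x)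

⋆-outside-image : (ψ : Fin n → Fin m) (h : Fin n → ℤ) → ∀ {y} → (∀ x → ψ x ≢ y) → (ψ ⋆ h) y ≡ 0ℤ
⋆-outside-image ψ h {y} y∉im = sum-zero λ x → when-false (ψ x ≟ y) (y∉im x) _

⋆-unique-preimage : (ψ : Fin n → Fin m) (h : Fin n → ℤ) → ∀ {x y} → ψ x ≡ y →
                    (∀ x′ → ψ x′ ≡ y → x′ ≡ x) → (ψ ⋆ h) y ≡ h x
⋆-unique-preimage ψ h {x} {y} ψx≡y unique =
  trans (sum-at _ x (λ x′ x′≢x → when-false (ψ x′ ≟ y) (x′≢x ∘ unique x′) _)) (when-true (ψ x ≟ y) ψx≡y _)

module Groupification {c ℓ} (M : CommutativeMonoid c ℓ) where
  open CommutativeMonoid M renaming (refl to ≈-refl; sym to ≈-sym; trans to ≈-trans)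
  open Theory M
  open import Algebra.Solver.CommutativeMonoid M using (solve; _⊕_; _⊜_)
  open SetoidReasoning setoid

  ≈ᵍ-refl : ∀ {A} → A ≈ᵍ A
  ≈ᵍ-refl = ≈-refl

  ≈ᵍ-sym : ∀ {A B} → A ≈ᵍ B → B ≈ᵍ A
  ≈ᵍ-sym {_ , _} {_ , _} = ≈-sym

  ≈ᵍ-trans : IsIntegral → ∀ {A B C} → A ≈ᵍ B → B ≈ᵍ C → A ≈ᵍ C
  ≈ᵍ-trans integral {a , a′} {b , b′} {c , c′} ab bc = integral (b ∙ b′) (a ∙ c′) (c ∙ a′) (begin
    (b ∙ b′) ∙ (a ∙ c′) ≈⟨ solve 4 (λ b b′ a c′ → (b ⊕ b′) ⊕ (a ⊕ c′) ⊜ (a ⊕ b′) ⊕ (b ⊕ c′)) ≈-refl b b′ a c′ ⟩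
    (a ∙ b′) ∙ (b ∙ c′) ≈⟨ ∙-cong ab bc ⟩
    (b ∙ a′) ∙ (c ∙ b′) ≈⟨ solve 4 (λ b a′ c b′ → (b ⊕ a′) ⊕ (c ⊕ b′) ⊜ (b ⊕ b′) ⊕ (c ⊕ a′)) ≈-refl b a′ c b′ ⟩
    (b ∙ b′) ∙ (c ∙ a′) ∎)

  gp-setoid : IsIntegral → Setoid c ℓ
  gp-setoid integral = record
    { Carrier       = Gp
    ; _≈_           = _≈ᵍ_
    ; isEquivalence = record { refl = ≈ᵍ-refl ; sym = ≈ᵍ-sym ; trans = ≈ᵍ-trans integral }
    }

  negᵍ : Gp → Gp
  negᵍ (a , a′) = (a′ , a)

  negᵍ-cong : ∀ {A B} → A ≈ᵍ B → negᵍ A ≈ᵍ negᵍ B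
  negᵍ-cong {_ , _} {_ , _} ab = ≈-trans (comm _ _) (≈-trans (≈-sym ab) (comm _ _))

  -ᵍ-anticomm : ∀ A B → (B -ᵍ A) ≈ᵍ negᵍ (A -ᵍ B)
  -ᵍ-anticomm (a , a′) (b , b′) =
    solve 4 (λ a a′ b b′ → (b ⊕ a′) ⊕ (a ⊕ b′) ⊜ (a′ ⊕ b) ⊕ (b′ ⊕ a)) ≈-refl a a′ b b′

  -ᵍ-cong : ∀ {A A′ B B′} → A ≈ᵍ A′ → B ≈ᵍ B′ → (A -ᵍ B) ≈ᵍ (A′ -ᵍ B′)
  -ᵍ-cong {a , a′} {c , c′} {b , b′} {d , d′} p q = begin
    (a ∙ b′) ∙ (c′ ∙ d) ≈⟨ solve 4 (λ a b′ c′ d → (a ⊕ b′) ⊕ (c′ ⊕ d) ⊜ (a ⊕ c′) ⊕ (d ⊕ b′)) ≈-refl a b′ c′ d ⟩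
    (a ∙ c′) ∙ (d ∙ b′) ≈⟨ ∙-cong p (≈-sym q) ⟩
    (c ∙ a′) ∙ (b ∙ d′) ≈⟨ solve 4 (λ c a′ b d′ → (c ⊕ a′) ⊕ (b ⊕ d′) ⊜ (c ⊕ d′) ⊕ (a′ ⊕ b)) ≈-refl c a′ b d′ ⟩
    (c ∙ d′) ∙ (a′ ∙ b) ∎

  -ᵍ≈0⇒≈ᵍ : ∀ {A B} → (A -ᵍ B) ≈ᵍ (ε , ε) → A ≈ᵍ B
  -ᵍ≈0⇒≈ᵍ {a , a′} {b , b′} d≈0 = begin
    a ∙ b′         ≈⟨ identityʳ _ ⟨
    (a ∙ b′) ∙ ε   ≈⟨ d≈0 ⟩
    ε ∙ (a′ ∙ b)   ≈⟨ identityˡ _ ⟩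
    a′ ∙ b         ≈⟨ comm _ _ ⟩
    b ∙ a′         ∎

  nmul-cong : ∀ k {l l′} → l ≈ l′ → nmul k l ≈ nmul k l′
  nmul-cong zero    _    = ≈-refl
  nmul-cong (suc k) l≈l′ = ∙-cong l≈l′ (nmul-cong k l≈l′)

  nmul-ε : ∀ k → nmul k ε ≈ ε
  nmul-ε zero    = ≈-refl
  nmul-ε (suc k) = ≈-trans (identityˡ _) (nmul-ε k)

  nmul-+ : ∀ a b l → nmul a l ∙ nmul b l ≈ nmul (a +ℕ b) l
  nmul-+ zero    b l = identityˡ _
  nmul-+ (suc a) b l = ≈-trans (assoc _ _ _) (∙-cong ≈-refl (nmul-+ a b l))

  nmul-injective : IsSharp → IsIntegral → ∀ {l} → ¬ l ≈ ε → ∀ {a b} → nmul a l ≈ nmul b l → a ≡ b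
  nmul-injective sharp integral l≉ε {zero}  {zero}  _ = refl
  nmul-injective sharp integral l≉ε {zero}  {suc b} e = contradiction (sharp _ _ (≈-sym e)) l≉ε
  nmul-injective sharp integral l≉ε {suc a} {zero}  e = contradiction (sharp _ _ e) l≉ε
  nmul-injective sharp integral l≉ε {suc a} {suc b} e =
    cong suc (nmul-injective sharp integral l≉ε (integral _ _ _ e))

  zmul-cong : ∀ z {l l′} → l ≈ l′ → zmul z l ≈ᵍ zmul z l′
  zmul-cong (+ k)    l≈l′ = ∙-cong (nmul-cong k l≈l′) ≈-refl
  zmul-cong -[1+ k ] l≈l′ = ∙-cong ≈-refl (≈-sym (nmul-cong (suc k) l≈l′))

  zmul-ε : ∀ z → zmul z ε ≈ᵍ (ε , ε)
  zmul-ε (+ k)    = ∙-cong (nmul-ε k) ≈-refl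
  zmul-ε -[1+ k ] = ∙-cong ≈-refl (≈-sym (nmul-ε (suc k)))

  zmul-neg : ∀ z l → zmul (- z) l ≡ negᵍ (zmul z l)
  zmul-neg (+ zero)  _ = refl
  zmul-neg (+ suc _) _ = refl
  zmul-neg -[1+ _ ]  _ = refl

  zmul-injective : IsSharp → IsIntegral → ∀ {l} → ¬ l ≈ ε → ∀ {a b} → zmul a l ≈ᵍ zmul b l → a ≡ b
  zmul-injective sharp integral l≉ε {+ p} {+ q} e =
    cong +_ (inj (≈-trans (≈-sym (identityʳ _)) (≈-trans e (identityʳ _))))
    where inj = nmul-injective sharp integral l≉ε
  zmul-injective sharp integral {l} l≉ε {+ p} { -[1+ q ]} e =
    contradiction (nmul-injective sharp integral l≉ε {suc q +ℕ p} {0}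
                    (≈-trans (≈-sym (nmul-+ (suc q) p l)) (≈-trans (comm _ _) (≈-trans e (identityˡ ε)))))
                  λ ()
  zmul-injective sharp integral {l} l≉ε { -[1+ p ]} {+ q} e =
    contradiction (nmul-injective sharp integral l≉ε {suc p +ℕ q} {0}
                    (≈-trans (≈-sym (nmul-+ (suc p) q l)) (≈-trans (comm _ _) (≈-trans (≈-sym e) (identityˡ ε)))))
                  λ ()
  zmul-injective sharp integral l≉ε { -[1+ p ]} { -[1+ q ]} e =
    cong -[1+_] (ℕ.suc-injective (sym (nmul-injective sharp integral l≉ε (integral _ _ _ e))))

module GroupificationMap {c₁ ℓ₁ c₂ ℓ₂} (M : CommutativeMonoid c₁ ℓ₁) (N : CommutativeMonoid c₂ ℓ₂)
  (f : CommutativeMonoid.Carrier M → CommutativeMonoid.Carrier N)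
  (hom : IsMonoidHomomorphism (CommutativeMonoid.rawMonoid M) (CommutativeMonoid.rawMonoid N) f) where
  private
    module MM = CommutativeMonoid M
    module NN = CommutativeMonoid N
    module TM = Theory M
    module TN = Theory N
  open IsMonoidHomomorphism hom
  open SetoidReasoning NN.setoid

  mapᵍ : TM.Gp → TN.Gp
  mapᵍ (a , a′) = (f a , f a′)

  mapᵍ-cong : ∀ {A B} → A TM.≈ᵍ B → mapᵍ A TN.≈ᵍ mapᵍ B
  mapᵍ-cong {a , a′} {b , b′} ab = begin
    f a NN.∙ f b′   ≈⟨ homo a b′ ⟨
    f (a MM.∙ b′)   ≈⟨ ⟦⟧-cong ab ⟩
    f (b MM.∙ a′)   ≈⟨ homo b a′ ⟩
    f b NN.∙ f a′   ∎

  mapᵍ--ᵍ : ∀ A B → mapᵍ (A TM.-ᵍ B) TN.≈ᵍ (mapᵍ A TN.-ᵍ mapᵍ B)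
  mapᵍ--ᵍ (a , a′) (b , b′) = NN.∙-cong (homo a b′) (NN.sym (homo a′ b))

  f-nmul : ∀ k l → f (TM.nmul k l) NN.≈ TN.nmul k (f l)
  f-nmul zero    l = ε-homo
  f-nmul (suc k) l = NN.trans (homo _ _) (NN.∙-cong NN.refl (f-nmul k l))

  mapᵍ-zmul : ∀ z l → mapᵍ (TM.zmul z l) TN.≈ᵍ TN.zmul z (f l)
  mapᵍ-zmul (+ k)    l = NN.∙-cong (f-nmul k l) (NN.sym ε-homo)
  mapᵍ-zmul -[1+ k ] l = NN.∙-cong ε-homo (NN.sym (f-nmul (suc k) l))

module MGraphFacts {c ℓ} (M : CommutativeMonoid c ℓ) (Γ : Theory.MGraph M) where
  open Decidable⇒UIP (_≟_ {Theory.MGraph.size Γ}) using (≡-irrelevant)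
  open CommutativeMonoid M using (_≈_; ε)
  open Theory M
  open MGraph Γ
  open Graph graph
  open Groupification M

  Δ : (Fin size → ℤ) → Div Γ
  Δ s v = sumFin (λ e → halfAt Γ v e (s e))

  HasSlopes : (Vertex Γ → Gp) → (Fin size → ℤ) → Set ℓ
  HasSlopes g s = (e : Fin size) → ¬ (r e ≡ e) → (g (vtx Γ e) -ᵍ g (vtx Γ (i e))) ≈ᵍ zmul (s e) (len e)

  divisor : (Fin size → ℤ) → Div Γ
  divisor h v = h (proj₁ v)

  onHalfEdges : (Fin size → ℤ) → Fin size → ℤ
  onHalfEdges s e = when (¬? (r e ≟ e)) (s e)

  vertex-≡ : ∀ {x y} {p : r x ≡ x} {q : r y ≡ y} → x ≡ y → _≡_ {A = Vertex Γ} (x , p) (y , q)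
  vertex-≡ {p = p} {q} refl = cong (_ ,_) (≡-irrelevant p q)

  i-half : ∀ {e} → ¬ r e ≡ e → ¬ r (i e) ≡ i e
  i-half {e} half ie-vertex = half (subst (λ x → r x ≡ x) (i-invol e) (fix→ (i (i e)) ie-fixed))
    where
    ie-fixed : i (i (i e)) ≡ i (i e)
    ie-fixed = cong i (fix← (i e) ie-vertex)

  coeff-vertex : (D : Div Γ) → ∀ {x} (p : r x ≡ x) → coeff Γ D x ≡ D (x , p)
  coeff-vertex D {x} p with r x ≟ x
  ... | yes _  = cong D (vertex-≡ refl)
  ... | no ¬p  = contradiction p ¬p

  coeff-cong : {D D′ : Div Γ} → (∀ v → D v ≡ D′ v) → ∀ x → coeff Γ D x ≡ coeff Γ D′ x
  coeff-cong D≗D′ x with r x ≟ x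
  ... | yes p = D≗D′ (x , p)
  ... | no _  = refl

  coeff-- : (D D′ : Div Γ) → ∀ x → coeff Γ (λ v → D v - D′ v) x ≡ coeff Γ D x - coeff Γ D′ x
  coeff-- D D′ x with r x ≟ x
  ... | yes _ = refl
  ... | no _  = refl

  coeff-nonneg : {D : Div Γ} → Effective Γ D → ∀ x → 0ℤ ≤ coeff Γ D x
  coeff-nonneg D≥0 x with r x ≟ x
  ... | yes p = D≥0 (x , p)
  ... | no _  = ℤ.≤-refl

  r⋆coeff : (D : Div Γ) → ∀ x → (r ⋆ coeff Γ D) x ≡ coeff Γ D x
  r⋆coeff D x = trans (⋆-agree (coeff Γ D) supported-on-vertices x) (⋆-id (coeff Γ D) x)
    where
    supported-on-vertices : ∀ w → r w ≡ w ⊎ coeff Γ D w ≡ 0ℤ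
    supported-on-vertices w with r w ≟ w
    ... | yes p = inj₁ p
    ... | no _  = inj₂ refl

  coeff-Δ : ∀ s x → coeff Γ (Δ s) x ≡ (r ⋆ onHalfEdges s) x
  coeff-Δ s x with r x ≟ x
  ... | yes x-vertex = sum-cong term
    where
    term : ∀ e → halfAt Γ (x , x-vertex) e (s e) ≡ when (r e ≟ x) (onHalfEdges s e)
    term e with e ≟ x
    ... | yes refl with r e ≟ e
    ...   | yes _ = refl
    ...   | no ¬v = contradiction x-vertex ¬v
    term e | no e≢x with r e ≟ x
    ...   | yes re≡x = sym (when-true (¬? (r e ≟ e)) (λ re≡e → e≢x (trans (sym re≡e) re≡x)) (s e))
    ...   | no _     = refl
  ... | no ¬x-vertex = sym (sum-zero λ e → when-false (r e ≟ x) (λ re≡x → ¬x-vertex (r-fixed re≡x)) _)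
    where
    r-fixed : ∀ {e} → r e ≡ x → r x ≡ x
    r-fixed {e} re≡x = trans (cong r (sym re≡x)) (trans (r-idem e) re≡x)

  onHalfEdges-antisym : ∀ {s} → (∀ e → ¬ r e ≡ e → s (i e) ≡ - s e) →
                        ∀ e → onHalfEdges s (i e) ≡ - onHalfEdges s e
  onHalfEdges-antisym {s} anti e with r e ≟ e
  ... | yes e-vertex = trans (cong (onHalfEdges s) (fix← e e-vertex))
                             (when-false (¬? (r e ≟ e)) (λ ¬v → ¬v e-vertex) (s e))
  ... | no half      = trans (when-true (¬? (r (i e) ≟ i e)) (i-half half) _) (anti e half)

  slopes-antisym : IsSharp → IsIntegral → ∀ {g s} → HasSlopes g s →
                   ∀ e → ¬ r e ≡ e → s (i e) ≡ - s e
  slopes-antisym sharp integral {g} {s} slopes e half =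
    zmul-injective sharp integral (half ∘ len-zero→ e) (begin
      zmul (s (i e)) (len e)                    ≈⟨ zmul-cong (s (i e)) (len-i e) ⟨
      zmul (s (i e)) (len (i e))                ≈⟨ slopes (i e) (i-half half) ⟨
      g (vtx Γ (i e)) -ᵍ g (vtx Γ (i (i e)))    ≡⟨ cong (λ x → g (vtx Γ (i e)) -ᵍ g (vtx Γ x)) (i-invol e) ⟩
      g (vtx Γ (i e)) -ᵍ g (vtx Γ e)            ≈⟨ -ᵍ-anticomm (g (vtx Γ e)) (g (vtx Γ (i e))) ⟩
      negᵍ (g (vtx Γ e) -ᵍ g (vtx Γ (i e)))     ≈⟨ negᵍ-cong (slopes e half) ⟩
      negᵍ (zmul (s e) (len e))                 ≡⟨ zmul-neg (s e) (len e) ⟨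
      zmul (- s e) (len e)                      ∎)
    where open SetoidReasoning (gp-setoid integral)

  ∼-respʳ : {E D₁ D₂ : Div Γ} → (∀ v → D₁ v ≡ D₂ v) → _∼_ Γ E D₁ → _∼_ Γ E D₂
  ∼-respʳ {E} D₁≗D₂ (g , s , slopes , E-D₁≡Δ) =
    g , s , slopes , λ v → trans (cong (λ t → E v - t) (sym (D₁≗D₂ v))) (E-D₁≡Δ v)

module PushForward {c₁ ℓ₁ c₂ ℓ₂}
  (M : CommutativeMonoid c₁ ℓ₁) (N : CommutativeMonoid c₂ ℓ₂)
  (sharpM : Theory.IsSharp M) (integralM : Theory.IsIntegral M) (integralN : Theory.IsIntegral N)
  (Γ : Theory.MGraph M)
  (f : CommutativeMonoid.Carrier M → CommutativeMonoid.Carrier N)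
  (hom : IsMonoidHomomorphism (CommutativeMonoid.rawMonoid M) (CommutativeMonoid.rawMonoid N) f)
  (Γ′ : Theory.MGraph N)
  (φ : Fin (Theory.MGraph.size Γ) → Fin (Theory.MGraph.size Γ′))
  (contraction : Contraction.IsContraction M N f Γ Γ′ φ) where

  open import Relation.Binary.Construct.Closure.ReflexiveTransitive using (ε; _◅_)
  open import Relation.Binary.Construct.Closure.Symmetric using (fwd; bwd)
  open import Relation.Binary.Construct.Closure.Equivalence using (gfold; return)

  private
    module NN = CommutativeMonoid N
    module TM = Theory M
    module TN = Theory N
    module G  = Theory.MGraph Γ
    module G′ = Theory.MGraph Γ′
    module 𝔾  = MGraphFacts M Γ
    module 𝔾′ = MGraphFacts N Γ′
    X  = Fin G.size
    X′ = Fin G′.size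
  open Theory using (Div; Vertex; Effective; vtx; coeff; deg; _∼_; RankCond)
  open Theory N using (_≈ᵍ_; _-ᵍ_; zmul)
  open Graph G.graph using (r; i; r-idem; i-invol; fix←)
  open Graph G′.graph using () renaming (r to r′; i to i′; r-idem to r′-idem; fix← to fix←′)
  open Contraction M N f Γ Γ′ using (Near; Step; pushCoeff)
  open Contraction.IsContraction contraction
  open GroupificationMap M N f hom
  open Groupification N using (gp-setoid; -ᵍ≈0⇒≈ᵍ; -ᵍ-cong; zmul-cong; zmul-ε)

  push : Div M Γ → Div N Γ′
  push = Contraction.push M N f Γ Γ′ φ

  image-vertex : ∀ {x} → r x ≡ x → r′ (φ x) ≡ φ x
  image-vertex {x} x-vertex = trans (r-compat x) (cong φ x-vertex)

  near-contracted⇒vertex : ∀ {x e} → f (G.len e) NN.≈ NN.ε → Near x e → r′ (φ x) ≡ φ x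
  near-contracted⇒vertex {x} {e} fe≈ε near =
    trans (r-compat x) (sym (fibre← x (r x) (return (e , fe≈ε , near , root near))))
    where
    root : ∀ {y} → Near y e → Near (r y) e
    root (inj₁ refl)               = inj₂ (inj₁ refl)
    root (inj₂ (inj₁ refl))        = inj₂ (inj₁ (r-idem e))
    root (inj₂ (inj₂ (inj₁ refl))) = inj₂ (inj₂ (inj₂ refl))
    root (inj₂ (inj₂ (inj₂ refl))) = inj₂ (inj₂ (inj₂ (r-idem (i e))))

  fibre-of-half-edge : ∀ {x x′} → ¬ r′ (φ x) ≡ φ x → φ x′ ≡ φ x → x′ ≡ x
  fibre-of-half-edge {x} {x′} half φx′≡φx with fibre→ x x′ (sym φx′≡φx)
  ... | ε                             = refl
  ... | fwd (_ , fe≈ε , near , _) ◅ _ = contradiction (near-contracted⇒vertex fe≈ε near) half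
  ... | bwd (_ , fe≈ε , _ , near) ◅ _ = contradiction (near-contracted⇒vertex fe≈ε near) half

  φ-i-vertex : ∀ {e} → r′ (φ e) ≡ φ e → φ (i e) ≡ φ e
  φ-i-vertex {e} φe-vertex = trans (sym (i-compat e)) (fix←′ (φ e) φe-vertex)

  τ : X′ → X
  τ y = proj₁ (surj y)

  φ∘τ : ∀ y → φ (τ y) ≡ y
  φ∘τ y = proj₂ (surj y)

  τ-half : ∀ {y} → ¬ r′ y ≡ y → ¬ r′ (φ (τ y)) ≡ φ (τ y)
  τ-half {y} = subst (λ t → ¬ r′ t ≡ t) (sym (φ∘τ y))

  -- τ y may be a half-edge contracted onto y; σ y is a vertex of Γ over r′ y.
  σ : X′ → X
  σ = r ∘ τ

  σ-vertex : ∀ y → r (σ y) ≡ σ y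
  σ-vertex y = r-idem (τ y)

  φ∘σ : ∀ y → φ (σ y) ≡ r′ y
  φ∘σ y = trans (sym (r-compat (τ y))) (cong r′ (φ∘τ y))

  pushCoeff≡when : ∀ D y x → pushCoeff φ D y x ≡ when (φ x ≟ y) (coeff M Γ D x)
  pushCoeff≡when D y x with r x ≟ x
  ... | no _ = sym (when-0 (φ x ≟ y))
  ... | yes _ with φ x ≟ y
  ...   | yes _ = refl
  ...   | no _  = refl

  push-⋆ : ∀ D w → push D w ≡ (φ ⋆ coeff M Γ D) (proj₁ w)
  push-⋆ D w = sum-cong (pushCoeff≡when D (proj₁ w))

  push-cong : ∀ {D₁ D₂} → (∀ v → D₁ v ≡ D₂ v) → ∀ w → push D₁ w ≡ push D₂ w
  push-cong {D₁} {D₂} D₁≗D₂ w =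
    trans (push-⋆ D₁ w) (trans (⋆-cong φ (𝔾.coeff-cong D₁≗D₂) (proj₁ w)) (sym (push-⋆ D₂ w)))

  push-- : ∀ D₁ D₂ w → push (λ v → D₁ v - D₂ v) w ≡ push D₁ w - push D₂ w
  push-- D₁ D₂ w = begin
    push (λ v → D₁ v - D₂ v) w
      ≡⟨ push-⋆ _ w ⟩
    (φ ⋆ coeff M Γ (λ v → D₁ v - D₂ v)) (proj₁ w)
      ≡⟨ ⋆-cong φ (𝔾.coeff-- D₁ D₂) (proj₁ w) ⟩
    (φ ⋆ (λ x → coeff M Γ D₁ x - coeff M Γ D₂ x)) (proj₁ w)
      ≡⟨ ⋆-- φ (coeff M Γ D₁) (coeff M Γ D₂) (proj₁ w) ⟩
    (φ ⋆ coeff M Γ D₁) (proj₁ w) - (φ ⋆ coeff M Γ D₂) (proj₁ w)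
      ≡⟨ cong₂ _-_ (push-⋆ D₁ w) (push-⋆ D₂ w) ⟨
    push D₁ w - push D₂ w ∎
    where open ≡-Reasoning

  push-effective : ∀ {D} → Effective M Γ D → Effective N Γ′ (push D)
  push-effective {D} D≥0 w = subst (0ℤ ≤_) (sym (push-⋆ D w)) (⋆-nonneg φ (𝔾.coeff-nonneg D≥0) (proj₁ w))

  lift : Div N Γ′ → Div M Γ
  lift F′ = 𝔾.divisor (σ ⋆ coeff N Γ′ F′)

  coeff-lift : ∀ F′ x → coeff M Γ (lift F′) x ≡ (σ ⋆ coeff N Γ′ F′) x
  coeff-lift F′ x with r x ≟ x
  ... | yes _ = refl
  ... | no x-half = sym (⋆-outside-image σ _ λ y σy≡x → x-half (subst (λ t → r t ≡ t) σy≡x (σ-vertex y)))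

  lift-effective : ∀ {F′} → Effective N Γ′ F′ → Effective M Γ (lift F′)
  lift-effective F′≥0 v = ⋆-nonneg σ (𝔾′.coeff-nonneg F′≥0) (proj₁ v)

  deg-lift : ∀ F′ → deg M Γ (lift F′) ≡ deg N Γ′ F′
  deg-lift F′ = trans (sum-cong (coeff-lift F′)) (sum-⋆ σ (coeff N Γ′ F′))

  push-lift : ∀ F′ w → push (lift F′) w ≡ F′ w
  push-lift F′ (y , y-vertex) = begin
    push (lift F′) (y , y-vertex)  ≡⟨ push-⋆ (lift F′) (y , y-vertex) ⟩
    (φ ⋆ coeff M Γ (lift F′)) y    ≡⟨ ⋆-cong φ (coeff-lift F′) y ⟩
    (φ ⋆ σ ⋆ coeff N Γ′ F′) y      ≡⟨ ⋆-∘ φ σ _ y ⟩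
    ((φ ∘ σ) ⋆ coeff N Γ′ F′) y    ≡⟨ ⋆-agree _ (inj₁ ∘ φ∘σ) y ⟩
    (r′ ⋆ coeff N Γ′ F′) y         ≡⟨ 𝔾′.r⋆coeff F′ y ⟩
    coeff N Γ′ F′ y                ≡⟨ 𝔾′.coeff-vertex F′ y-vertex ⟩
    F′ (y , y-vertex)              ∎
    where open ≡-Reasoning

  module _ (g : Vertex M Γ → TM.Gp) (s : X → ℤ) (slopes : 𝔾.HasSlopes g s) where

    s′ : X′ → ℤ
    s′ = s ∘ τ

    ⋆-onHalfEdges-over-vertex : ∀ {y} → r′ y ≡ y → (φ ⋆ 𝔾.onHalfEdges s) y ≡ 0ℤ
    ⋆-onHalfEdges-over-vertex {y} y-vertex = sum-antisymmetric _ i i-invol antisym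
      where
      open ≡-Reasoning
      i-closed : ∀ {e} → φ e ≡ y → φ (i e) ≡ y
      i-closed φe≡y = trans (φ-i-vertex (subst (λ t → r′ t ≡ t) (sym φe≡y) y-vertex)) φe≡y
      antisym : ∀ e → when (φ (i e) ≟ y) (𝔾.onHalfEdges s (i e)) ≡ - when (φ e ≟ y) (𝔾.onHalfEdges s e)
      antisym e = begin
        when (φ (i e) ≟ y) (𝔾.onHalfEdges s (i e))
          ≡⟨ when-equiv (subst (λ t → φ t ≡ y) (i-invol e) ∘ i-closed) i-closed (φ (i e) ≟ y) (φ e ≟ y) _ ⟩
        when (φ e ≟ y) (𝔾.onHalfEdges s (i e))
          ≡⟨ cong (when (φ e ≟ y)) (𝔾.onHalfEdges-antisym (𝔾.slopes-antisym sharpM integralM {g} {s} slopes) e) ⟩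
        when (φ e ≟ y) (- 𝔾.onHalfEdges s e)
          ≡⟨ when-neg (φ e ≟ y) _ ⟩
        - when (φ e ≟ y) (𝔾.onHalfEdges s e) ∎

    φ⋆onHalfEdges : ∀ y → (φ ⋆ 𝔾.onHalfEdges s) y ≡ 𝔾′.onHalfEdges s′ y
    φ⋆onHalfEdges y with r′ y ≟ y
    ... | yes y-vertex = ⋆-onHalfEdges-over-vertex y-vertex
    ... | no y-half =
      trans (⋆-unique-preimage φ _ (φ∘τ y) λ x φx≡y → fibre-of-half-edge (τ-half y-half) (trans φx≡y (sym (φ∘τ y))))
            (when-true (¬? (r (τ y) ≟ τ y)) (τ-half y-half ∘ image-vertex) (s (τ y)))

    push-Δ : ∀ w → push (𝔾.Δ s) w ≡ 𝔾′.Δ s′ w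
    push-Δ (y , y-vertex) = begin
      push (𝔾.Δ s) (y , y-vertex)     ≡⟨ push-⋆ (𝔾.Δ s) (y , y-vertex) ⟩
      (φ ⋆ coeff M Γ (𝔾.Δ s)) y       ≡⟨ ⋆-cong φ (𝔾.coeff-Δ s) y ⟩
      (φ ⋆ r ⋆ 𝔾.onHalfEdges s) y     ≡⟨ ⋆-∘ φ r _ y ⟩
      ((φ ∘ r) ⋆ 𝔾.onHalfEdges s) y   ≡⟨ ⋆-agree _ (λ x → inj₁ (sym (r-compat x))) y ⟩
      ((r′ ∘ φ) ⋆ 𝔾.onHalfEdges s) y  ≡⟨ ⋆-∘ r′ φ _ y ⟨
      (r′ ⋆ φ ⋆ 𝔾.onHalfEdges s) y    ≡⟨ ⋆-cong r′ φ⋆onHalfEdges y ⟩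
      (r′ ⋆ 𝔾′.onHalfEdges s′) y      ≡⟨ 𝔾′.coeff-Δ s′ y ⟨
      coeff N Γ′ (𝔾′.Δ s′) y          ≡⟨ 𝔾′.coeff-vertex (𝔾′.Δ s′) y-vertex ⟩
      𝔾′.Δ s′ (y , y-vertex)          ∎
      where open ≡-Reasoning

    open Setoid (gp-setoid integralN) using (isEquivalence)
      renaming (refl to ≈ᵍ-refl; sym to ≈ᵍ-sym; trans to ≈ᵍ-trans; reflexive to ≈ᵍ-reflexive)
    module ≈ᵍ-Reasoning = SetoidReasoning (gp-setoid integralN)

    ĝ : X → TN.Gp
    ĝ x = mapᵍ (g (vtx M Γ x))

    ĝ-root : ∀ {a b} → r a ≡ r b → ĝ a ≡ ĝ b
    ĝ-root = cong (mapᵍ ∘ g) ∘ 𝔾.vertex-≡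

    ĝ-contracted : ∀ {e} → f (G.len e) NN.≈ NN.ε → ĝ e ≈ᵍ ĝ (i e)
    ĝ-contracted {e} fe≈ε with r e ≟ e
    ... | yes e-vertex = ≈ᵍ-reflexive (cong ĝ (sym (fix← e e-vertex)))
    ... | no e-half    = -ᵍ≈0⇒≈ᵍ (begin
      ĝ e -ᵍ ĝ (i e)                                   ≈⟨ mapᵍ--ᵍ _ _ ⟨
      mapᵍ (g (vtx M Γ e) TM.-ᵍ g (vtx M Γ (i e)))  ≈⟨ mapᵍ-cong (slopes e e-half) ⟩
      mapᵍ (TM.zmul (s e) (G.len e))             ≈⟨ mapᵍ-zmul (s e) (G.len e) ⟩
      zmul (s e) (f (G.len e))                         ≈⟨ zmul-cong (s e) fe≈ε ⟩
      zmul (s e) NN.ε                                  ≈⟨ zmul-ε (s e) ⟩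
      (NN.ε , NN.ε)                                    ∎)
      where open ≈ᵍ-Reasoning

    ĝ-near : ∀ {x e} → f (G.len e) NN.≈ NN.ε → Near x e → ĝ x ≈ᵍ ĝ e
    ĝ-near fe≈ε (inj₁ refl)                = ≈ᵍ-refl
    ĝ-near {e = e} fe≈ε (inj₂ (inj₁ refl)) = ≈ᵍ-reflexive (ĝ-root (r-idem e))
    ĝ-near fe≈ε (inj₂ (inj₂ (inj₁ refl)))  = ≈ᵍ-sym (ĝ-contracted fe≈ε)
    ĝ-near {e = e} fe≈ε (inj₂ (inj₂ (inj₂ refl))) =
      ≈ᵍ-trans (≈ᵍ-reflexive (ĝ-root (r-idem (i e)))) (≈ᵍ-sym (ĝ-contracted fe≈ε))

    ĝ-step : ∀ {a b} → Step a b → ĝ a ≈ᵍ ĝ b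
    ĝ-step (_ , fe≈ε , near-a , near-b) = ≈ᵍ-trans (ĝ-near fe≈ε near-a) (≈ᵍ-sym (ĝ-near fe≈ε near-b))

    ĝ-fibre : ∀ {a b} → r′ (φ a) ≡ r′ (φ b) → ĝ a ≈ᵍ ĝ b
    ĝ-fibre {a} {b} eq = begin
      ĝ a      ≡⟨ ĝ-root (sym (r-idem a)) ⟩
      ĝ (r a)  ≈⟨ gfold isEquivalence ĝ ĝ-step (fibre→ (r a) (r b) φra≡φrb) ⟩
      ĝ (r b)  ≡⟨ ĝ-root (r-idem b) ⟩
      ĝ b      ∎
      where
      open ≈ᵍ-Reasoning
      φra≡φrb : φ (r a) ≡ φ (r b)
      φra≡φrb = trans (sym (r-compat a)) (trans eq (r-compat b))

    g′ : Vertex N Γ′ → TN.Gp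
    g′ w = ĝ (τ (proj₁ w))

    g′-vtx : ∀ {x y} → r′ (φ x) ≡ r′ y → g′ (vtx N Γ′ y) ≈ᵍ ĝ x
    g′-vtx {x} {y} eq = ĝ-fibre (trans (cong r′ (φ∘τ (r′ y))) (trans (r′-idem y) (sym eq)))

    g′-slopes : 𝔾′.HasSlopes g′ s′
    g′-slopes y y-half = begin
      g′ (vtx N Γ′ y) -ᵍ g′ (vtx N Γ′ (i′ y))          ≈⟨ -ᵍ-cong (g′-vtx (cong r′ (φ∘τ y))) (g′-vtx (cong r′ φit≡i′y)) ⟩
      ĝ t -ᵍ ĝ (i t)                                   ≈⟨ mapᵍ--ᵍ _ _ ⟨
      mapᵍ (g (vtx M Γ t) TM.-ᵍ g (vtx M Γ (i t)))  ≈⟨ mapᵍ-cong (slopes t (τ-half y-half ∘ image-vertex)) ⟩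
      mapᵍ (TM.zmul (s t) (G.len t))             ≈⟨ mapᵍ-zmul (s t) (G.len t) ⟩
      zmul (s t) (f (G.len t))                         ≈⟨ zmul-cong (s t) (NN.sym (l-compat t)) ⟩
      zmul (s t) (G′.len (φ t))                        ≡⟨ cong (λ e → zmul (s t) (G′.len e)) (φ∘τ y) ⟩
      zmul (s′ y) (G′.len y)                           ∎
      where
      open ≈ᵍ-Reasoning
      t = τ y
      φit≡i′y : φ (i t) ≡ i′ y
      φit≡i′y = trans (sym (i-compat t)) (cong i′ (φ∘τ y))

  push-∼ : ∀ {E D} → _∼_ M Γ E D → _∼_ N Γ′ (push E) (push D)
  push-∼ {E} {D} (g , s , slopes , E-D≡Δ) =
    g′ g s slopes , s′ g s slopes , g′-slopes g s slopes ,
    λ w → trans (sym (push-- E D w)) (trans (push-cong E-D≡Δ w) (push-Δ g s slopes w))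

  rankCond-push : ∀ D k → RankCond M Γ D k → RankCond N Γ′ (push D) k
  rankCond-push D k rank F′ F′≥0 degF′≡k
    with rank (lift F′) (lift-effective F′≥0) (trans (deg-lift F′) degF′≡k)
  ... | E , E≥0 , E∼D-F =
    push E , push-effective E≥0 , 𝔾′.∼-respʳ {push E} push-D-F≡D′-F′ (push-∼ {E} E∼D-F)
    where
    push-D-F≡D′-F′ : ∀ w → push (λ v → D v - lift F′ v) w ≡ push D w - F′ w
    push-D-F≡D′-F′ w = trans (push-- D (lift F′) w) (cong (λ t → push D w - t) (push-lift F′ w))

lemma4p4 : ∀ {c₁ ℓ₁ c₂ ℓ₂}
    (M : CommutativeMonoid c₁ ℓ₁) (N : CommutativeMonoid c₂ ℓ₂) →
    Theory.IsSharp M → Theory.IsIntegral M →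
    Theory.IsSharp N → Theory.IsIntegral N →
    (Γ : Theory.MGraph M) →
    (f : CommutativeMonoid.Carrier M → CommutativeMonoid.Carrier N) →
    IsMonoidHomomorphism (CommutativeMonoid.rawMonoid M) (CommutativeMonoid.rawMonoid N) f →
    (Γ' : Theory.MGraph N) →
    (φ : Fin (Theory.MGraph.size Γ) → Fin (Theory.MGraph.size Γ')) →
    Contraction.IsContraction M N f Γ Γ' φ →
    (D : Theory.Div M Γ) → (ρ ρ' : ℤ) →
    Theory.IsRank M Γ D ρ →
    Theory.IsRank N Γ' (Contraction.push M N f Γ Γ' φ D) ρ' →
    ρ ≤ ρ'
lemma4p4 M N sharpM integralM _ integralN Γ f hom Γ′ φ contraction D ρ ρ′ (ρ-attained , _) (_ , ρ′-maximal) =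
  ρ′-maximal ρ (PushForward.rankCond-push M N sharpM integralM integralN Γ f hom Γ′ φ contraction D ρ ρ-attained)
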